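{- Let $n \geq 1$ and let $G$ be the sibling tree $ST_n$. Then the locating-domination number of $G$ is $$\gamma^{L}(G) = \begin{cases} \frac{1}{5}(2^{n+2}+1) & \text{if } n\equiv 0 \pmod 4,\\ \frac{1}{5}(2^{n+2}+2) & \text{if } n\equiv 1 \pmod 4,\\ \frac{1}{5}(2^{n+2}-1) & \text{if } n\equiv 2 \pmod 4,\\ \frac{1}{5}(2^{n+2}-2) & \text{if } n\equiv 3 \pmod 4.\end{cases}$$
   Context: The sibling tree $ST_n$ has vertex set $\{1,2,\dots,2^{n+1}-1\}$; its edges are the edges of the complete binary tree of height $n$ in which vertex $x$ has children $2x$ and $2x+1$ (root $1$ at level $0$; vertex $v$ is at level $i$ iff $2^i\le v\le 2^{i+1}-1$), together with the sibling edges $\{2x,2x+1\}$ for every $x$ with $1\le x\le 2^n-1$. A locating-dominating set of $G$ is a set $S\subseteq V(G)$ such that every vertex of $V(G)\setminus S$ is adjacent to some vertex of $S$, and for every two distinct vertices $u,v\in V(G)\setminus S$, $N(u)\cap S\neq N(v)\cap S$ (open neighborhoods). $\gamma^{L}(G)$ is the minimum cardinality of a locating-dominating set. -}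

module Defs where

open import Data.Nat using (ℕ; zero; suc; _+_; _*_; _∸_; _^_; _≤_; _<_; _/_; _%_)
open import Data.List using (List; length)
open import Data.List.Membership.Propositional using (_∈_)
open import Data.List.Relation.Unary.Unique.Propositional using (Unique)
open import Data.Product using (Σ; ∃; _×_; _,_)
open import Data.Sum using (_⊎_)
open import Relation.Nullary using (¬_)
open import Relation.Binary.PropositionalEquality using (_≡_)

Vertex : ℕ → ℕ → Set
Vertex n v = 1 ≤ v × v < 2 ^ (suc n)

data Adj : ℕ → ℕ → Set where
  child-l  : ∀ x → Adj x (2 * x)
  child-r  : ∀ x → Adj x (2 * x + 1)
  parent-l : ∀ x → Adj (2 * x) x
  parent-r : ∀ x → Adj (2 * x + 1) x
  sib-lr   : ∀ x → 1 ≤ x → Adj (2 * x) (2 * x + 1)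
  sib-rl   : ∀ x → 1 ≤ x → Adj (2 * x + 1) (2 * x)

record IsLocDom (n : ℕ) (S : List ℕ) : Set where
  field
    unique    : Unique S
    vertices  : ∀ {s} → s ∈ S → Vertex n s
    dominates : ∀ v → Vertex n v → ¬ (v ∈ S) → ∃ λ s → s ∈ S × Adj v s
    locates   : ∀ u v → Vertex n u → Vertex n v → ¬ (u ∈ S) → ¬ (v ∈ S) → ¬ (u ≡ v) →
                ¬ (∀ s → s ∈ S → (Adj u s → Adj v s) × (Adj v s → Adj u s))

IsLocDomNumber : ℕ → ℕ → Set
IsLocDomNumber n k =
  (∃ λ S → IsLocDom n S × length S ≡ k) ×
  (∀ S → IsLocDom n S → k ≤ length S)

formula : ℕ → ℕ
formula n with n % 4
... | 0 = (2 ^ (n + 2) + 1) / 5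
... | 1 = (2 ^ (n + 2) + 2) / 5
... | 2 = (2 ^ (n + 2) ∸ 1) / 5
... | _ = (2 ^ (n + 2) ∸ 2) / 5

module Submission where

-- Vertices are described by addresses: bit strings a read downwards from an
-- anchor G, pos G a.
--
-- For a locating-dominating set S, induction over the subtrees
-- whose leaves lie on the last level shows 4·2^h + surplus ≤ 5·|S ∩ subtree| + 4.
-- The surplus is a table indexed by h mod 4 and three flags of the subtree
-- root; one level step keeps the bound in every configuration allowed by three
-- local conditions on S (the root is dominated, two childless children are
-- located, the root and a childless child are located), which is verified by
-- enumerating the 256 configurations.
--
-- The construction chooses a vertex by its height mod 4 and its
-- label mod 8, plus the root when n ≡ 0, 1 (mod 4).  An exact version of the
-- same recursion counts it.  Near any anchor it agrees with a finite model
-- depending on the height of the anchor above the leaves (clipped below 8,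
-- keeping its residue mod 4), its label mod 8 and whether it is the root;
-- domination and location are checked on the model for all these parameters
-- and transferred to ST_n through addresses.

open import Defs
open import Data.Nat
open import Data.Nat.Properties
open import Data.Nat.DivMod
open import Data.Nat.Logarithm
open import Data.Nat.Tactic.RingSolver using (solve-∀)
open import Data.Bool using (Bool; true; false; not; _∧_; _∨_; T)
open import Data.Bool.Properties using (¬-not; not-¬; ∧-assoc; ∧-identityʳ; ∧-zeroʳ; ∨-identityʳ; T-≡; T-∨) renaming (_≟_ to _≟𝔹_)
open import Data.Bool.ListAction using (all; any)
open import Data.List using (List; []; _∷_; length; _++_; _∷ʳ_; null; filterᵇ; upTo; cartesianProduct)
open import Data.List.Properties using (∷ʳ-injective; length-++; filter-++; length-removeAt′; ≡-dec)
open import Data.List.Membership.Propositional using (_∈_; _∉_; find)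
open import Data.List.Membership.Propositional.Properties using (∈-++⁻; ∈-++⁺ˡ; ∈-++⁺ʳ; ∈-filter⁺; ∈-filter⁻; ∈-cartesianProduct⁺; ∈-upTo⁺)
open import Data.List.Membership.DecPropositional _≟_ using (_∈?_)
import Data.List.Membership.DecPropositional as DecMembership
open import Data.List.Relation.Unary.Any using (here; there; _─_)
open import Data.List.Relation.Unary.Any.Properties using (any⁻)
open import Data.List.Relation.Unary.All as All using (All; []; _∷_)
open import Data.List.Relation.Unary.All.Properties using (all⁺)
open import Data.List.Relation.Unary.AllPairs using (_∷_; [])
open import Data.List.Relation.Unary.Unique.Propositional using (Unique)
import Data.List.Relation.Unary.Unique.Propositional.Properties as Unique
open import Data.Product using (∃; ∃-syntax; _×_; _,_; proj₁; proj₂)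
open import Data.Sum using (_⊎_; inj₁; inj₂)
open import Data.Unit using (tt)
open import Data.Empty using (⊥; ⊥-elim)
open import Function using (_∘_)
open import Function.Bundles using (Equivalence; mk⇔)
open import Relation.Nullary using (¬_; Dec; yes; no; isYes)
open import Relation.Nullary.Decidable using (does-⇔)
open import Relation.Nullary.Decidable.Core using (T?; toWitness; toWitnessFalse; fromWitnessFalse)
open import Relation.Binary.Definitions using (DecidableEquality)
open import Relation.Binary.PropositionalEquality

child : Bool → ℕ → ℕ
child false x = 2 * x
child true  x = 2 * x + 1

child-injective : ∀ d d′ {x y} → child d x ≡ child d′ y → d ≡ d′ × x ≡ y
child-injective false false {x} {y} e = refl , *-cancelˡ-≡ x y 2 e
child-injective true  true  {x} {y} e = refl , *-cancelˡ-≡ x y 2 (+-cancelʳ-≡ 1 _ _ e)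
child-injective false true  {x} {y} e = ⊥-elim (even≢odd x y (trans e (+-comm (2 * y) 1)))
child-injective true  false {x} {y} e = ⊥-elim (even≢odd y x (trans (sym e) (+-comm (2 * x) 1)))

child-≥ : ∀ d x → 2 * x ≤ child d x
child-≥ false x = ≤-refl
child-≥ true  x = m≤m+n (2 * x) 1

child-> : ∀ d {x} → 1 ≤ x → x < child d x
child-> d {x} x≥1 = <-≤-trans x<2x (child-≥ d x)
  where
  x<2x : x < 2 * x
  x<2x = subst (x <_) (cong (x +_) (sym (+-identityʳ x))) (m<m+n x x≥1)

Adj-child : ∀ d x → Adj x (child d x)
Adj-child false x = child-l x
Adj-child true  x = child-r x

Adj-parent : ∀ d x → Adj (child d x) x
Adj-parent false x = parent-l x
Adj-parent true  x = parent-r x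

Adj-sibling : ∀ d x → 1 ≤ x → Adj (child d x) (child (not d) x)
Adj-sibling false x x≥1 = sib-lr x x≥1
Adj-sibling true  x x≥1 = sib-rl x x≥1

data AdjView (x y : ℕ) : Set where
  down   : ∀ d → y ≡ child d x → AdjView x y
  up     : ∀ d → x ≡ child d y → AdjView x y
  across : ∀ d z → 1 ≤ z → x ≡ child d z → y ≡ child (not d) z → AdjView x y

adjView : ∀ {x y} → Adj x y → AdjView x y
adjView (child-l x)    = down false refl
adjView (child-r x)    = down true refl
adjView (parent-l x)   = up false refl
adjView (parent-r x)   = up true refl
adjView (sib-lr x x≥1) = across false x x≥1 refl refl
adjView (sib-rl x x≥1) = across true x x≥1 refl refl

-- An address is a downward path read from its last step: pos G (d ∷ a) is the
-- child d of pos G a.  Addresses let us reason about the shape of ST_n near a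
-- vertex independently of where that vertex sits in the tree.
Addr : Set
Addr = List Bool

pos : ℕ → Addr → ℕ
pos G []      = G
pos G (d ∷ a) = child d (pos G a)

pos-≥ : ∀ G a → G ≤ pos G a
pos-≥ G []      = ≤-refl
pos-≥ G (d ∷ a) = ≤-trans (pos-≥ G a) (≤-trans (m≤n*m (pos G a) 2) (child-≥ d (pos G a)))

pos-> : ∀ {G} d a → 1 ≤ G → G < pos G (d ∷ a)
pos-> d a G≥1 = ≤-<-trans (pos-≥ _ a) (child-> d (≤-trans G≥1 (pos-≥ _ a)))

pos-++ : ∀ G a b → pos G (a ++ b) ≡ pos (pos G b) a
pos-++ G []      b = refl
pos-++ G (d ∷ a) b = cong (child d) (pos-++ G a b)

pos-injective : ∀ {G} → 1 ≤ G → ∀ a b → pos G a ≡ pos G b → a ≡ b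
pos-injective G≥1 []      []      e = refl
pos-injective G≥1 []      (d ∷ b) e = ⊥-elim (<-irrefl e (pos-> d b G≥1))
pos-injective G≥1 (d ∷ a) []      e = ⊥-elim (<-irrefl (sym e) (pos-> d a G≥1))
pos-injective G≥1 (d ∷ a) (d′ ∷ b) e with child-injective d d′ e
... | refl , e′ = cong (d ∷_) (pos-injective G≥1 a b e′)

Adj-irrefl : ∀ {x} → 1 ≤ x → ¬ Adj x x
Adj-irrefl x≥1 a with adjView a
... | down d e = <-irrefl e (child-> d x≥1)
... | up d e   = <-irrefl e (child-> d x≥1)
... | across d z _ e₁ e₂ with child-injective d (not d) (trans (sym e₁) e₂)
... | d≡¬d , _ = not-¬ refl d≡¬d

Adj-sym : ∀ {x y} → Adj x y → Adj y x
Adj-sym (child-l x)    = parent-l x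
Adj-sym (child-r x)    = parent-r x
Adj-sym (parent-l x)   = child-l x
Adj-sym (parent-r x)   = child-r x
Adj-sym (sib-lr x x≥1) = sib-rl x x≥1
Adj-sym (sib-rl x x≥1) = sib-lr x x≥1

neighbours : Addr → List Addr
neighbours []      = (false ∷ []) ∷ (true ∷ []) ∷ []
neighbours (d ∷ a) = (false ∷ d ∷ a) ∷ (true ∷ d ∷ a) ∷ a ∷ (not d ∷ a) ∷ []

child∈neighbours : ∀ d a → (d ∷ a) ∈ neighbours a
child∈neighbours false []      = here refl
child∈neighbours true  []      = there (here refl)
child∈neighbours false (_ ∷ _) = here refl
child∈neighbours true  (_ ∷ _) = there (here refl)

neighbours-adjacent : ∀ {G} → 1 ≤ G → ∀ a {b} → b ∈ neighbours a → Adj (pos G a) (pos G b)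
neighbours-adjacent G≥1 []      (here refl)                       = Adj-child false _
neighbours-adjacent G≥1 []      (there (here refl))               = Adj-child true _
neighbours-adjacent G≥1 (d ∷ a) (here refl)                       = Adj-child false _
neighbours-adjacent G≥1 (d ∷ a) (there (here refl))               = Adj-child true _
neighbours-adjacent G≥1 (d ∷ a) (there (there (here refl)))       = Adj-parent d _
neighbours-adjacent G≥1 (d ∷ a) (there (there (there (here refl)))) =
  Adj-sibling d _ (≤-trans G≥1 (pos-≥ _ a))

neighbour-address : ∀ {G u} a → 1 ≤ G → (a ≡ [] → G ≡ 1) → 1 ≤ u → Adj (pos G a) u →
                    ∃[ b ] b ∈ neighbours a × u ≡ pos G b
neighbour-address {G} {u} a G≥1 root u≥1 adj with adjView adj
... | down d e = d ∷ a , child∈neighbours d a , e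
neighbour-address []      G≥1 root u≥1 adj | up d e with child-injective true d {0} (trans (sym (root refl)) e)
... | _ , refl = ⊥-elim (<-irrefl refl u≥1)
neighbour-address (d′ ∷ a) G≥1 root u≥1 adj | up d e with child-injective d′ d e
... | refl , e′ = a , there (there (here refl)) , sym e′
neighbour-address []      G≥1 root u≥1 adj | across d z z≥1 e₁ _
  with child-injective true d {0} (trans (sym (root refl)) e₁)
... | _ , refl = ⊥-elim (<-irrefl refl z≥1)
neighbour-address (d′ ∷ a) G≥1 root u≥1 adj | across d z z≥1 e₁ e₂ with child-injective d′ d e₁
... | refl , e′ = not d′ ∷ a , there (there (there (here refl))) , trans e₂ (cong (child (not d′)) (sym e′))

adjacent-neighbours : ∀ {G} → 1 ≤ G → ∀ a b → Adj (pos G a) (pos G b) → b ∈ neighbours a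
adjacent-neighbours G≥1 (d ∷ a) b adj
  with neighbour-address (d ∷ a) G≥1 (λ ()) (≤-trans G≥1 (pos-≥ _ b)) adj
... | b′ , b′∈ , e rewrite pos-injective G≥1 b b′ e = b′∈
adjacent-neighbours G≥1 [] [] adj = ⊥-elim (Adj-irrefl G≥1 adj)
adjacent-neighbours G≥1 [] (d ∷ b) adj
  with neighbour-address (d ∷ b) G≥1 (λ ()) G≥1 (Adj-sym adj)
... | c , c∈ , e with pos-injective G≥1 [] c e
... | refl = parent-is-root c∈
  where
  parent-is-root : ∀ {d b} → [] ∈ neighbours (d ∷ b) → (d ∷ b) ∈ neighbours []
  parent-is-root {d} (there (there (here refl))) = child∈neighbours d []
  parent-is-root (here ())
  parent-is-root (there (here ()))
  parent-is-root (there (there (there (here ()))))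

child-neighbours : ∀ d {v s} → 1 ≤ v → 1 ≤ s → Adj (child d v) s →
                   (∃[ d′ ] s ≡ child d′ (child d v)) ⊎ s ≡ v ⊎ s ≡ child (not d) v
child-neighbours d v≥1 s≥1 adj with neighbour-address (d ∷ []) v≥1 (λ ()) s≥1 adj
... | _ , here refl , e                             = inj₁ (false , e)
... | _ , there (here refl) , e                     = inj₁ (true , e)
... | _ , there (there (here refl)) , e             = inj₂ (inj₁ e)
... | _ , there (there (there (here refl))) , e     = inj₂ (inj₂ e)

root-neighbours : ∀ {s} → 1 ≤ s → Adj 1 s → ∃[ d ] s ≡ child d 1
root-neighbours s≥1 adj with neighbour-address [] ≤-refl (λ _ → refl) s≥1 adj
... | _ , here refl , e         = false , e
... | _ , there (here refl) , e = true , e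

split : ∀ x → ∃[ d ] ∃[ y ] x ≡ child d y
split zero          = false , 0 , refl
split (suc zero)    = true , 0 , refl
split (suc (suc x)) with split x
... | d , y , refl = d , suc y , sym (two-more d y)
  where
  two-more : ∀ d y → child d (suc y) ≡ suc (suc (child d y))
  two-more false y = *-suc 2 y
  two-more true  y = cong (_+ 1) (*-suc 2 y)

half-child : ∀ d x → ⌊ child d x /2⌋ ≡ x
half-child d zero    with d
... | false = refl
... | true  = refl
half-child false (suc x) = trans (cong ⌊_/2⌋ (*-suc 2 x)) (cong suc (half-child false x))
half-child true  (suc x) = trans (cong ⌊_/2⌋ (cong (_+ 1) (*-suc 2 x))) (cong suc (half-child true x))

root-address : ∀ {x} → 1 ≤ x → ∃[ a ] x ≡ pos 1 a
root-address {x} x≥1 = go (suc x) x ≤-refl x≥1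
  where
  go : ∀ k x → x < k → 1 ≤ x → ∃[ a ] x ≡ pos 1 a
  go (suc k) x x<k x≥1 with split x
  ... | false , zero , refl = ⊥-elim (<-irrefl refl x≥1)
  ... | true  , zero , refl = [] , refl
  ... | d , suc y , refl with go k (suc y) (<-≤-trans (child-> d (s≤s z≤n)) (≤-pred x<k)) (s≤s z≤n)
  ...   | a , e = d ∷ a , cong (child d) e

level : ℕ → ℕ
level x = ⌊log₂ x ⌋

level-child : ∀ d {x} → 1 ≤ x → level (child d x) ≡ suc (level x)
level-child d {x} x≥1 = begin
  level (child d x)             ≡⟨ sym (m+[n∸m]≡n level≥1) ⟩
  suc (level (child d x) ∸ 1)   ≡⟨ cong suc (sym (⌊log₂⌊n/2⌋⌋≡⌊log₂n⌋∸1 (child d x))) ⟩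
  suc (level ⌊ child d x /2⌋)   ≡⟨ cong (suc ∘ level) (half-child d x) ⟩
  suc (level x)                 ∎
  where
  open ≡-Reasoning
  level≥1 : 1 ≤ level (child d x)
  level≥1 = ≤-trans (s≤s z≤n) (≤-trans (≤-reflexive (sym (⌊log₂[2*b]⌋≡1+⌊log₂b⌋ x {{>-nonZero x≥1}})))
                                      (⌊log₂⌋-mono-≤ (child-≥ d x)))

level-pos : ∀ {G} a → 1 ≤ G → level (pos G a) ≡ level G + length a
level-pos []      G≥1 = sym (+-identityʳ _)
level-pos {G} (d ∷ a) G≥1 = begin
  level (child d (pos G a))   ≡⟨ level-child d (≤-trans G≥1 (pos-≥ G a)) ⟩
  suc (level (pos G a))       ≡⟨ cong suc (level-pos a G≥1) ⟩
  suc (level G + length a)    ≡⟨ sym (+-suc (level G) (length a)) ⟩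
  level G + suc (length a)    ∎
  where open ≡-Reasoning

level-root : ∀ a → level (pos 1 a) ≡ length a
level-root a = level-pos a ≤-refl

root-layer : ∀ a → 2 ^ length a ≤ pos 1 a × pos 1 a < 2 ^ suc (length a)
root-layer []      = ≤-refl , ≤-refl
root-layer (d ∷ a) with root-layer a
... | lo , hi = ≤-trans (*-monoʳ-≤ 2 lo) (child-≥ d _) , <-≤-trans (child-< d _) (*-monoʳ-≤ 2 hi)
  where
  child-< : ∀ d x → child d x < 2 * suc x
  child-< false x = *-monoʳ-< 2 (n<1+n x)
  child-< true  x = ≤-reflexive (trans (cong suc (+-comm (2 * x) 1)) (sym (*-suc 2 x)))

vertex⇒address : ∀ {n x} → Vertex n x → ∃[ a ] length a ≤ n × x ≡ pos 1 a
vertex⇒address {n} (x≥1 , x<) with root-address x≥1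
... | a , refl with length a ≤? n
...   | yes |a|≤n = a , |a|≤n , refl
...   | no  |a|≰n = ⊥-elim (<⇒≱ x< (≤-trans (^-monoʳ-≤ 2 (≰⇒> |a|≰n)) (proj₁ (root-layer a))))

address⇒vertex : ∀ {n} a → length a ≤ n → Vertex n (pos 1 a)
address⇒vertex a |a|≤n =
  ≤-trans (m^n>0 2 (length a)) (proj₁ (root-layer a)) ,
  <-≤-trans (proj₂ (root-layer a)) (^-monoʳ-≤ 2 (s≤s |a|≤n))

level⇒vertex : ∀ {n x} → 1 ≤ x → level x ≤ n → Vertex n x
level⇒vertex x≥1 lvl≤n with root-address x≥1
... | a , refl = address⇒vertex a (≤-trans (≤-reflexive (sym (level-root a))) lvl≤n)

vertex⇒level : ∀ {n x} → Vertex n x → level x ≤ n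
vertex⇒level v with vertex⇒address v
... | a , |a|≤n , refl = ≤-trans (≤-reflexive (level-root a)) |a|≤n

subtree : ℕ → ℕ → List ℕ
subtree zero    v = v ∷ []
subtree (suc h) v = v ∷ (subtree h (child false v) ++ subtree h (child true v))

∈-subtree-child⁺ : ∀ h v d {x} → x ∈ subtree h (child d v) → x ∈ subtree (suc h) v
∈-subtree-child⁺ h v false p = there (∈-++⁺ˡ p)
∈-subtree-child⁺ h v true  p = there (∈-++⁺ʳ (subtree h (child false v)) p)

∈-subtree-child⁻ : ∀ h v {x} → x ∈ subtree (suc h) v → x ≡ v ⊎ ∃[ d ] x ∈ subtree h (child d v)
∈-subtree-child⁻ h v (here refl) = inj₁ refl
∈-subtree-child⁻ h v (there p) with ∈-++⁻ (subtree h (child false v)) p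
... | inj₁ q = inj₂ (false , q)
... | inj₂ q = inj₂ (true , q)

∈-subtree⁻ : ∀ h v {x} → x ∈ subtree h v → ∃[ a ] length a ≤ h × x ≡ pos v a
∈-subtree⁻ zero    v (here refl) = [] , z≤n , refl
∈-subtree⁻ (suc h) v p with ∈-subtree-child⁻ h v p
... | inj₁ refl = [] , z≤n , refl
... | inj₂ (d , q) with ∈-subtree⁻ h (child d v) q
...   | a , |a|≤h , refl =
  a ∷ʳ d , ≤-trans (≤-reflexive (trans (length-++ a) (+-comm (length a) 1))) (s≤s |a|≤h) ,
  sym (pos-++ v a (d ∷ []))

child-∈-subtree : ∀ h v d {x} → x ∈ subtree h v → child d x ∈ subtree (suc h) v
child-∈-subtree zero    v d (here refl) = ∈-subtree-child⁺ 0 v d (here refl)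
child-∈-subtree (suc h) v d p with ∈-subtree-child⁻ h v p
... | inj₁ refl      = ∈-subtree-child⁺ (suc h) v d (here refl)
... | inj₂ (d′ , q) = ∈-subtree-child⁺ (suc h) v d′ (child-∈-subtree h (child d′ v) d q)

∈-subtree⁺ : ∀ {h} v a → length a ≤ h → pos v a ∈ subtree h v
∈-subtree⁺ {zero}  v []      _         = here refl
∈-subtree⁺ {suc h} v []      _         = here refl
∈-subtree⁺ {suc h} v (d ∷ a) (s≤s |a|≤h) = child-∈-subtree h v d (∈-subtree⁺ v a |a|≤h)

-- Below a positive root, a subtree lists each vertex once: addresses are
-- injective, and the two child subtrees end in different bits.
subtree-unique : ∀ h v → 1 ≤ v → Unique (subtree h v)
subtree-unique zero    v v≥1 = [] ∷ []
subtree-unique (suc h) v v≥1 =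
  All.tabulate root-fresh ∷ Unique.++⁺ (subtree-unique h (child false v) (below false))
                                      (subtree-unique h (child true v) (below true))
                                      disjoint
  where
  below : ∀ d → 1 ≤ child d v
  below d = <⇒≤ (≤-<-trans v≥1 (child-> d v≥1))
  via-child : ∀ d {x} → x ∈ subtree h (child d v) → ∃[ a ] x ≡ pos v (a ∷ʳ d)
  via-child d q with ∈-subtree⁻ h (child d v) q
  ... | a , _ , refl = a , sym (pos-++ v a (d ∷ []))
  snoc≢[] : ∀ (a : Addr) d → a ∷ʳ d ≢ []
  snoc≢[] []      d ()
  snoc≢[] (_ ∷ _) d ()
  root-fresh : ∀ {x} → x ∈ subtree h (child false v) ++ subtree h (child true v) → v ≢ x
  root-fresh p refl with ∈-++⁻ (subtree h (child false v)) p
  ... | inj₁ q = let (a , e) = via-child false q in snoc≢[] a false (pos-injective v≥1 _ [] (sym e))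
  ... | inj₂ q = let (a , e) = via-child true q in snoc≢[] a true (pos-injective v≥1 _ [] (sym e))
  disjoint : ∀ {x} → ¬ (x ∈ subtree h (child false v) × x ∈ subtree h (child true v))
  disjoint (p , q) with via-child false p | via-child true q
  ... | a , e | b , e′ with ∷ʳ-injective a b (pos-injective v≥1 _ _ (trans (sym e) e′))
  ...   | _ , ()

vertex⇒∈-subtree : ∀ {n x} → Vertex n x → x ∈ subtree n 1
vertex⇒∈-subtree v with vertex⇒address v
... | a , |a|≤n , refl = ∈-subtree⁺ 1 a |a|≤n

∈-─ : ∀ {A : Set} {x y : A} {ys} (p : x ∈ ys) → y ∈ ys → y ≢ x → y ∈ (ys ─ p)
∈-─ (here refl) (here refl) y≢x = ⊥-elim (y≢x refl)
∈-─ (here _)    (there q)   _   = q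
∈-─ (there _)   (here e)    _   = here e
∈-─ (there p)   (there q)   y≢x = there (∈-─ p q y≢x)

unique-⊆-length : ∀ {A : Set} {xs ys : List A} → Unique xs → (∀ {x} → x ∈ xs → x ∈ ys) →
                  length xs ≤ length ys
unique-⊆-length {xs = []}     _             _   = z≤n
unique-⊆-length {xs = x ∷ xs} {ys} (x∉ ∷ u) xs⊆ys = begin
  suc (length xs)             ≤⟨ s≤s (unique-⊆-length u xs⊆rest) ⟩
  suc (length (ys ─ x∈ys))    ≡⟨ sym (length-removeAt′ ys _) ⟩
  length ys                   ∎
  where
  open ≤-Reasoning
  x∈ys : x ∈ ys
  x∈ys = xs⊆ys (here refl)
  xs⊆rest : ∀ {y} → y ∈ xs → y ∈ (ys ─ x∈ys)
  xs⊆rest y∈ = ∈-─ x∈ys (xs⊆ys (there y∈)) (≢-sym (All.lookup x∉ y∈))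

⟦_⟧ : Bool → ℕ
⟦ true ⟧  = 1
⟦ false ⟧ = 0

treeCount : (ℕ → Bool) → ℕ → ℕ → ℕ
treeCount p zero    v = ⟦ p v ⟧
treeCount p (suc h) v = ⟦ p v ⟧ + treeCount p h (child false v) + treeCount p h (child true v)

length-filterᵇ-∷ : ∀ {A : Set} (p : A → Bool) x xs →
                   length (filterᵇ p (x ∷ xs)) ≡ ⟦ p x ⟧ + length (filterᵇ p xs)
length-filterᵇ-∷ p x xs with p x
... | true  = refl
... | false = refl

treeCount-filter : ∀ p h v → length (filterᵇ p (subtree h v)) ≡ treeCount p h v
treeCount-filter p zero    v = trans (length-filterᵇ-∷ p v []) (+-identityʳ ⟦ p v ⟧)
treeCount-filter p (suc h) v = begin
  length (filterᵇ p (v ∷ (L ++ R)))                   ≡⟨ length-filterᵇ-∷ p v (L ++ R) ⟩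
  ⟦ p v ⟧ + length (filterᵇ p (L ++ R))               ≡⟨ cong (λ l → ⟦ p v ⟧ + length l) (filter-++ (T? ∘ p) L R) ⟩
  ⟦ p v ⟧ + length (filterᵇ p L ++ filterᵇ p R)       ≡⟨ cong (⟦ p v ⟧ +_) (length-++ (filterᵇ p L)) ⟩
  ⟦ p v ⟧ + (length (filterᵇ p L) + length (filterᵇ p R))
      ≡⟨ cong₂ (λ l r → ⟦ p v ⟧ + (l + r)) (treeCount-filter p h (child false v))
                                           (treeCount-filter p h (child true v)) ⟩
  ⟦ p v ⟧ + (treeCount p h (child false v) + treeCount p h (child true v))
      ≡⟨ sym (+-assoc ⟦ p v ⟧ (treeCount p h (child false v)) (treeCount p h (child true v))) ⟩
  treeCount p (suc h) v                               ∎
  where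
  open ≡-Reasoning
  L R : List ℕ
  L = subtree h (child false v)
  R = subtree h (child true v)

-- Heights matter only modulo 4.
data Mod4 : Set where
  r0 r1 r2 r3 : Mod4

next : Mod4 → Mod4
next r0 = r1
next r1 = r2
next r2 = r3
next r3 = r0

mod4 : ℕ → Mod4
mod4 zero    = r0
mod4 (suc h) = next (mod4 h)

∧-split : ∀ {a b} → T (a ∧ b) → T a × T b
∧-split {true} t = tt , t

∧-intro : ∀ {a b} → T a → T b → T (a ∧ b)
∧-intro {true} _ t = t

refute : ∀ {b} → (T b → ⊥) → T (not b)
refute {false} _ = tt
refute {true}  f = f tt

by-contradiction : ∀ {b} → (T (not b) → ⊥) → T b
by-contradiction {true}  _ = tt
by-contradiction {false} f = f tt

≤ᵇ-true : ∀ {m n} → m ≤ n → (m ≤ᵇ n) ≡ true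
≤ᵇ-true m≤n = Equivalence.to T-≡ (≤⇒≤ᵇ m≤n)

implication : ∀ {a b} → T (not a ∨ b) → T a → T b
implication {true} t _ = t

resolve : ∀ {a b} → T (a ∨ b) → T (not a) → T b
resolve {false} t _ = t

not-∨ : ∀ {a b} → T (not (a ∨ b)) → T (not a) × T (not b)
not-∨ {false} t = tt , t

-- A type together with a complete list of its elements: a boolean property of
-- all its elements can then be verified by evaluation.
record Finite (A : Set) : Set where
  field
    elements : List A
    complete : ∀ x → x ∈ elements
open Finite public

all-∈ : ∀ {A : Set} (p : A → Bool) xs → T (all p xs) → ∀ {x} → x ∈ xs → T (p x)
all-∈ p xs holds = All.lookup (all⁺ p xs holds)

by-enumeration : ∀ {A} (F : Finite A) (p : A → Bool) → T (all p (elements F)) → ∀ x → T (p x)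
by-enumeration F p holds x = all-∈ p (elements F) holds (complete F x)

finite-Bool : Finite Bool
finite-Bool = record { elements = false ∷ true ∷ [] ; complete = λ { false → here refl ; true → there (here refl) } }

finite-Mod4 : Finite Mod4
finite-Mod4 = record
  { elements = r0 ∷ r1 ∷ r2 ∷ r3 ∷ []
  ; complete = λ { r0 → here refl ; r1 → there (here refl) ; r2 → there (there (here refl))
                 ; r3 → there (there (there (here refl))) } }

finite-× : ∀ {A B} → Finite A → Finite B → Finite (A × B)
finite-× FA FB = record
  { elements = cartesianProduct (elements FA) (elements FB)
  ; complete = λ (x , y) → ∈-cartesianProduct⁺ (complete FA x) (complete FB y) }

-- surplus (mod4 h) e bv k is a lower bound, in fifths, on how many more
-- S-vertices than (4·2^h − 4)/5 a subtree of height h at the bottom of ST_n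
-- contains.  The flags: e — the root has an S-neighbour outside the subtree,
-- bv — the root is in S, k — no child of the root is in S.
surplus : Mod4 → Bool → Bool → Bool → ℕ
surplus r0 false false false = 5
surplus r0 false false true  = 12
surplus r0 false true  false = 10
surplus r0 false true  true  = 5
surplus r0 true  false false = 5
surplus r0 true  false true  = 0
surplus r0 true  true  false = 10
surplus r0 true  true  true  = 5
surplus r1 false false false = 6
surplus r1 false false true  = 12
surplus r1 false true  false = 6
surplus r1 false true  true  = 6
surplus r1 true  false false = 1
surplus r1 true  false true  = 6
surplus r1 true  true  false = 6
surplus r1 true  true  true  = 6
surplus r2 false false false = 3
surplus r2 false false true  = 12
surplus r2 false true  false = 8
surplus r2 false true  true  = 3
surplus r2 true  false false = 3
surplus r2 true  false true  = 8
surplus r2 true  true  false = 8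
surplus r2 true  true  true  = 3
surplus r3 false false false = 2
surplus r3 false false true  = 12
surplus r3 false true  false = 7
surplus r3 false true  true  = 7
surplus r3 true  false false = 2
surplus r3 true  false true  = 2
surplus r3 true  true  false = 7
surplus r3 true  true  true  = 7

dominatedᵇ : (e bv b₁ b₂ : Bool) → Bool
dominatedᵇ e bv b₁ b₂ = bv ∨ e ∨ b₁ ∨ b₂

-- Two children outside S with no children in S are told apart only if their
-- parent is outside S as well.
childrenLocatedᵇ : (bv b₁ k₁ b₂ k₂ : Bool) → Bool
childrenLocatedᵇ bv b₁ k₁ b₂ k₂ = not (bv ∧ not b₁ ∧ k₁ ∧ not b₂ ∧ k₂)

-- v ∉ S without outside S-neighbours and its child c ∉ S without children in S
-- are told apart only if the sibling c′ of c is outside S as well.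
parentLocatedᵇ : (e bv b k b′ : Bool) → Bool
parentLocatedᵇ e bv b k b′ = not (not e ∧ not bv ∧ not b ∧ k ∧ b′)

legalᵇ : (e bv b₁ k₁ b₂ k₂ : Bool) → Bool
legalᵇ e bv b₁ k₁ b₂ k₂ =
  dominatedᵇ e bv b₁ b₂ ∧ childrenLocatedᵇ bv b₁ k₁ b₂ k₂ ∧
  parentLocatedᵇ e bv b₁ k₁ b₂ ∧ parentLocatedᵇ e bv b₂ k₂ b₁

-- The surplus recursion: going one level up doubles 4·2^h and adds 5 per
-- S-vertex at the new root; in every legal configuration the surplus of the
-- parent is covered by those of the two children.
stepᵇ : Mod4 → (e bv b₁ k₁ b₂ k₂ : Bool) → Bool
stepᵇ ρ e bv b₁ k₁ b₂ k₂ =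
  not (legalᵇ e bv b₁ k₁ b₂ k₂) ∨
  (surplus (next ρ) e bv (not b₁ ∧ not b₂) + 4
     ≤ᵇ 5 * ⟦ bv ⟧ + surplus ρ (bv ∨ b₂) b₁ k₁ + surplus ρ (bv ∨ b₁) b₂ k₂)

Config : Set
Config = Mod4 × Bool × Bool × Bool × Bool × Bool × Bool

finite-Config : Finite Config
finite-Config = finite-× finite-Mod4 (finite-× finite-Bool (finite-× finite-Bool (finite-× finite-Bool
                  (finite-× finite-Bool (finite-× finite-Bool finite-Bool)))))

stepᵇ-holds : ∀ ρ e bv b₁ k₁ b₂ k₂ → T (stepᵇ ρ e bv b₁ k₁ b₂ k₂)
stepᵇ-holds ρ e bv b₁ k₁ b₂ k₂ =
  by-enumeration finite-Config (λ (ρ , e , bv , b₁ , k₁ , b₂ , k₂) → stepᵇ ρ e bv b₁ k₁ b₂ k₂) tt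
                 (ρ , e , bv , b₁ , k₁ , b₂ , k₂)

surplus-leaf : ∀ e bv k → T k → T (bv ∨ e) → 4 + surplus r0 e bv k ≤ 5 * ⟦ bv ⟧ + 4
surplus-leaf false true  true _ _ = ≤-refl
surplus-leaf true  false true _ _ = ≤-refl
surplus-leaf true  true  true _ _ = ≤-refl

combine-bounds : ∀ X c₁ c₂ cv d₁ d₂ d → X + d₁ ≤ 5 * c₁ + 4 → X + d₂ ≤ 5 * c₂ + 4 →
                 d + 4 ≤ 5 * cv + d₁ + d₂ → (X + X) + d ≤ 5 * (cv + c₁ + c₂) + 4
combine-bounds X c₁ c₂ cv d₁ d₂ d b₁ b₂ step = +-cancelʳ-≤ 4 _ _ (begin
  X + X + d + 4                           ≡⟨ +-assoc (X + X) d 4 ⟩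
  X + X + (d + 4)                         ≤⟨ +-monoʳ-≤ (X + X) step ⟩
  X + X + (5 * cv + d₁ + d₂)              ≡⟨ regroup X cv d₁ d₂ ⟩
  5 * cv + (X + d₁) + (X + d₂)            ≤⟨ +-mono-≤ (+-monoʳ-≤ (5 * cv) b₁) b₂ ⟩
  5 * cv + (5 * c₁ + 4) + (5 * c₂ + 4)    ≡⟨ collect cv c₁ c₂ ⟩
  5 * (cv + c₁ + c₂) + 4 + 4              ∎)
  where
  open ≤-Reasoning
  regroup : ∀ X cv d₁ d₂ → X + X + (5 * cv + d₁ + d₂) ≡ 5 * cv + (X + d₁) + (X + d₂)
  regroup = solve-∀
  collect : ∀ cv c₁ c₂ → 5 * cv + (5 * c₁ + 4) + (5 * c₂ + 4) ≡ 5 * (cv + c₁ + c₂) + 4 + 4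
  collect = solve-∀

module LowerBound {n : ℕ} {S : List ℕ} (L : IsLocDom n S) where
  open IsLocDom L

  inS : ℕ → Bool
  inS x = isYes (x ∈? S)

  childless : ℕ → Bool
  childless x = not (inS (child false x)) ∧ not (inS (child true x))

  in-S : ∀ {x} → T (inS x) → x ∈ S
  in-S {x} = toWitness {a? = x ∈? S}

  out-S : ∀ {x} → T (not (inS x)) → x ∉ S
  out-S {x} = toWitnessFalse {a? = x ∈? S}

  inS-false : ∀ {x} → x ∉ S → T (not (inS x))
  inS-false {x} = fromWitnessFalse {a? = x ∈? S}

  childless⇒ : ∀ {x} → T (childless x) → ∀ d → child d x ∉ S
  childless⇒ {x} t false = out-S (proj₁ (∧-split {not (inS (child false x))} t))
  childless⇒ {x} t true  = out-S (proj₂ (∧-split {not (inS (child false x))} t))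

  ⇒childless : ∀ {x} → (∀ d → child d x ∉ S) → T (childless x)
  ⇒childless out = ∧-intro (inS-false (out false)) (inS-false (out true))

  s≥1 : ∀ {s} → s ∈ S → 1 ≤ s
  s≥1 s∈ = proj₁ (vertices s∈)

  OnlyChildren : ℕ → Set
  OnlyChildren x = ∀ {s} → s ∈ S → Adj x s → ∃[ d ] s ≡ child d x

  onlyChildren-root : OnlyChildren 1
  onlyChildren-root s∈ = root-neighbours (s≥1 s∈)

  onlyChildren-child : ∀ d {v} → 1 ≤ v → v ∉ S → child (not d) v ∉ S → OnlyChildren (child d v)
  onlyChildren-child d v≥1 v∉ sib∉ s∈ adj with child-neighbours d v≥1 (s≥1 s∈) adj
  ... | inj₁ below        = below
  ... | inj₂ (inj₁ refl) = ⊥-elim (v∉ s∈)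
  ... | inj₂ (inj₂ refl) = ⊥-elim (sib∉ s∈)

  parent-only : ∀ d {v s} → 1 ≤ v → (∀ d′ → child d′ (child d v) ∉ S) → child (not d) v ∉ S →
                s ∈ S → Adj (child d v) s → s ≡ v
  parent-only d v≥1 out sib∉ s∈ adj with child-neighbours d v≥1 (s≥1 s∈) adj
  ... | inj₁ (d′ , refl)  = ⊥-elim (out d′ s∈)
  ... | inj₂ (inj₁ e)    = e
  ... | inj₂ (inj₂ refl) = ⊥-elim (sib∉ s∈)

  sibling-only : ∀ d {v s} → 1 ≤ v → (∀ d′ → child d′ (child d v) ∉ S) → v ∉ S →
                 s ∈ S → Adj (child d v) s → s ≡ child (not d) v
  sibling-only d v≥1 out v∉ s∈ adj with child-neighbours d v≥1 (s≥1 s∈) adj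
  ... | inj₁ (d′ , refl)  = ⊥-elim (out d′ s∈)
  ... | inj₂ (inj₁ refl) = ⊥-elim (v∉ s∈)
  ... | inj₂ (inj₂ e)    = e

  other-child-only : ∀ d {v s} → OnlyChildren v → child d v ∉ S → s ∈ S → Adj v s → s ≡ child (not d) v
  other-child-only d {v} only c∉ s∈ adj with only s∈ adj
  ... | d′ , refl = cong (λ b → child b v) (¬-not {d′} {d} (λ { refl → c∉ s∈ }))

  sole-neighbour : ∀ {u w} t → Vertex n u → Vertex n w → u ∉ S → w ∉ S → u ≢ w →
                   (∀ {s} → s ∈ S → Adj u s → s ≡ t) → (∀ {s} → s ∈ S → Adj w s → s ≡ t) →
                   Adj u t → Adj w t → ⊥
  sole-neighbour {u} {w} t vu vw u∉ w∉ u≢w only-u only-w ut wt =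
    locates u w vu vw u∉ w∉ u≢w λ s s∈ →
      (λ a → subst (Adj w) (sym (only-u s∈ a)) wt) , (λ a → subst (Adj u) (sym (only-w s∈ a)) ut)

  record Bottom (h v : ℕ) : Set where
    field
      positive : 1 ≤ v
      reaches  : level v + h ≡ n
  open Bottom

  bottom-child : ∀ d {h v} → Bottom (suc h) v → Bottom h (child d v)
  bottom-child d {h} {v} B = record
    { positive = ≤-trans (positive B) (<⇒≤ (child-> d (positive B)))
    ; reaches  = trans (cong (_+ h) (level-child d (positive B))) (trans (sym (+-suc (level v) h)) (reaches B)) }

  bottom-vertex : ∀ {h v} → Bottom h v → Vertex n v
  bottom-vertex {h} {v} B = level⇒vertex (positive B) (≤-trans (m≤m+n (level v) h) (≤-reflexive (reaches B)))

  leaf-childless : ∀ {v} → Bottom 0 v → ∀ d → child d v ∉ S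
  leaf-childless {v} B d c∈ = <-irrefl refl (≤-trans (≤-reflexive (sym level-c)) (vertex⇒level (vertices c∈)))
    where
    level-c : level (child d v) ≡ suc n
    level-c = trans (level-child d (positive B)) (cong suc (trans (sym (+-identityʳ (level v))) (reaches B)))

  dominated : ∀ {h v} → Bottom h v → OnlyChildren v → v ∉ S → ¬ (∀ d → child d v ∉ S)
  dominated B only v∉ out with dominates _ (bottom-vertex B) v∉
  ... | s , s∈ , adj with only s∈ adj
  ... | d , refl = out d s∈

  children-located : ∀ {h v} → Bottom (suc h) v → v ∈ S → (∀ d → child d v ∉ S) →
                     (∀ d d′ → child d′ (child d v) ∉ S) → ⊥
  children-located {v = v} B v∈ out grand-out =
    sole-neighbour v (bottom-vertex (bottom-child false B)) (bottom-vertex (bottom-child true B))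
      (out false) (out true) (λ e → case-false (proj₁ (child-injective false true {v} {v} e)))
      (parent-only false (positive B) (grand-out false) (out true))
      (parent-only true (positive B) (grand-out true) (out false))
      (Adj-parent false v) (Adj-parent true v)
    where
    case-false : false ≢ true
    case-false ()

  parent-located : ∀ d {h v} → Bottom (suc h) v → OnlyChildren v → v ∉ S → child d v ∉ S →
                   (∀ d′ → child d′ (child d v) ∉ S) → child (not d) v ∈ S → ⊥
  parent-located d {v = v} B only v∉ c∉ grand-out sib∈ =
    sole-neighbour (child (not d) v) (bottom-vertex B) (bottom-vertex (bottom-child d B))
      v∉ c∉ (λ e → <-irrefl e (child-> d (positive B)))
      (other-child-only d only c∉) (sibling-only d (positive B) grand-out v∉)
      (Adj-child (not d) v) (Adj-sibling d v (positive B))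

  legal : ∀ {h v e} → Bottom (suc h) v → (T (not e) → OnlyChildren v) →
          T (legalᵇ e (inS v) (inS (child false v)) (childless (child false v))
                              (inS (child true v))  (childless (child true v)))
  legal {h} {v} {e} B only = ∧-intro dom (∧-intro kids (∧-intro (told-apart false) (told-apart true)))
    where
    dom : T (dominatedᵇ e (inS v) (inS (child false v)) (inS (child true v)))
    dom = by-contradiction λ t →
      let (¬bv , t₁) = not-∨ {inS v} t ; (¬e , t₂) = not-∨ {e} t₁
          (¬b₁ , ¬b₂) = not-∨ {inS (child false v)} t₂
      in dominated B (only ¬e) (out-S ¬bv) λ { false → out-S ¬b₁ ; true → out-S ¬b₂ }
    kids : T (childrenLocatedᵇ (inS v) (inS (child false v)) (childless (child false v))
                                       (inS (child true v))  (childless (child true v)))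
    kids = refute λ t →
      let (bv , t₁) = ∧-split {inS v} t ; (¬b₁ , t₂) = ∧-split {not (inS (child false v))} t₁
          (k₁ , t₃) = ∧-split {childless (child false v)} t₂ ; (¬b₂ , k₂) = ∧-split {not (inS (child true v))} t₃
      in children-located B (in-S bv) (λ { false → out-S ¬b₁ ; true → out-S ¬b₂ })
                                      (λ { false → childless⇒ k₁ ; true → childless⇒ k₂ })
    told-apart : ∀ d → T (parentLocatedᵇ e (inS v) (inS (child d v)) (childless (child d v)) (inS (child (not d) v)))
    told-apart d = refute λ t →
      let (¬e , t₁) = ∧-split {not e} t ; (¬bv , t₂) = ∧-split {not (inS v)} t₁
          (¬b , t₃) = ∧-split {not (inS (child d v))} t₂ ; (k , b′) = ∧-split {childless (child d v)} t₃
      in parent-located d B (only ¬e) (out-S ¬bv) (out-S ¬b) (childless⇒ k) (in-S b′)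

  subtree-bound : ∀ h {v} e → Bottom h v → (T (not e) → OnlyChildren v) →
                  4 * 2 ^ h + surplus (mod4 h) e (inS v) (childless v) ≤ 5 * treeCount inS h v + 4
  subtree-bound zero {v} e B only =
    surplus-leaf e (inS v) (childless v) (⇒childless (leaf-childless B)) dom
    where
    dom : T (inS v ∨ e)
    dom = by-contradiction λ t → let (¬bv , ¬e) = not-∨ {inS v} t
                                 in dominated B (only ¬e) (out-S ¬bv) (leaf-childless B)
  subtree-bound (suc h) {v} e B only =
    subst (λ X → X + surplus (mod4 (suc h)) e (inS v) (childless v) ≤ 5 * treeCount inS (suc h) v + 4)
          (double (2 ^ h))
          (combine-bounds (4 * 2 ^ h) _ _ ⟦ inS v ⟧ _ _ _ (below false) (below true) step)
    where
    double : ∀ p → 4 * p + 4 * p ≡ 4 * (2 * p)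
    double = solve-∀
    b k : Bool → Bool
    b d = inS (child d v)
    k d = childless (child d v)
    below : ∀ d → 4 * 2 ^ h + surplus (mod4 h) (inS v ∨ b (not d)) (b d) (k d) ≤ 5 * treeCount inS h (child d v) + 4
    below d = subtree-bound h (inS v ∨ b (not d)) (bottom-child d B) λ t →
      let (¬bv , ¬sib) = not-∨ {inS v} t in onlyChildren-child d (positive B) (out-S ¬bv) (out-S ¬sib)
    step : surplus (mod4 (suc h)) e (inS v) (childless v) + 4
           ≤ 5 * ⟦ inS v ⟧ + surplus (mod4 h) (inS v ∨ b true) (b false) (k false)
                           + surplus (mod4 h) (inS v ∨ b false) (b true) (k true)
    step = ≤ᵇ⇒≤ _ _ (implication (stepᵇ-holds (mod4 h) e (inS v) (b false) (k false) (b true) (k true)) (legal B only))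

  root-bound : 4 * 2 ^ n + surplus (mod4 n) false (inS 1) (childless 1) ≤ 5 * length S + 4
  root-bound = ≤-trans (subtree-bound n false root (λ _ → onlyChildren-root))
                       (+-monoˡ-≤ 4 (*-monoʳ-≤ 5 count≤size))
    where
    root : Bottom n 1
    root = record { positive = ≤-refl ; reaches = refl }
    count≤size : treeCount inS n 1 ≤ length S
    count≤size = ≤-trans (≤-reflexive (sym (treeCount-filter inS n 1)))
                   (unique-⊆-length (Unique.filter⁺ (T? ∘ inS) (subtree-unique n 1 ≤-refl))
                                    (λ x∈ → in-S (proj₂ (∈-filter⁻ (T? ∘ inS) {xs = subtree n 1} x∈))))

-- The optimal set: a vertex at height h above the leaves is chosen according
-- to h mod 4 and its residue mod 8 ...
motif : Mod4 → ℕ → Bool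
motif r0 0 = true
motif r0 2 = true
motif r0 5 = true
motif r0 6 = true
motif r1 2 = true
motif r1 6 = true
motif r2 0 = true
motif r2 2 = true
motif r2 4 = true
motif r2 6 = true
motif _  _ = false

rootChosen : Mod4 → Bool
rootChosen r0 = true
rootChosen r1 = true
rootChosen _  = false

chosen : ℕ → ℕ → Bool
chosen n x = (1 ≤ᵇ x) ∧ (level x ≤ᵇ n) ∧
             (motif (mod4 (n ∸ level x)) (x % 8) ∨ ((x ≡ᵇ 1) ∧ rootChosen (mod4 n)))

child-mod : ∀ d x → child d x % 8 ≡ child d (x % 8) % 8
child-mod d x = begin
  child d x % 8                                    ≡⟨ cong (λ y → child d y % 8) (m≡m%n+[m/n]*n x 8) ⟩
  child d (x % 8 + x / 8 * 8) % 8                  ≡⟨ cong (_% 8) (shift d (x % 8) (x / 8)) ⟩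
  (child d (x % 8) + 2 * (x / 8) * 8) % 8          ≡⟨ [m+kn]%n≡m%n (child d (x % 8)) (2 * (x / 8)) 8 ⟩
  child d (x % 8) % 8                              ∎
  where
  open ≡-Reasoning
  shift : ∀ d r q → child d (r + q * 8) ≡ child d r + 2 * q * 8
  shift false r q = even r q
    where even : ∀ r q → 2 * (r + q * 8) ≡ 2 * r + 2 * q * 8
          even = solve-∀
  shift true  r q = odd r q
    where odd : ∀ r q → 2 * (r + q * 8) + 1 ≡ 2 * r + 1 + 2 * q * 8
          odd = solve-∀

-- In the count the excess of a subtree above (4·2^h − 4)/5, scaled by 5, depends
-- only on h mod 4 and the residue of its root mod 8.
excess : Mod4 → ℕ → ℕ
excess r0 0 = 5
excess r0 2 = 5
excess r0 5 = 5
excess r0 6 = 5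
excess r0 _ = 0
excess r1 2 = 6
excess r1 6 = 6
excess r1 _ = 1
excess r2 _ = 3
excess r3 _ = 2

excess-leaf : ∀ {r} → r < 8 → 5 * ⟦ motif r0 r ⟧ + 4 ≡ 4 + excess r0 r
excess-leaf r<8 =
  ≡ᵇ⇒≡ _ _ (all-∈ (λ r → 5 * ⟦ motif r0 r ⟧ + 4 ≡ᵇ 4 + excess r0 r) (upTo 8) tt (∈-upTo⁺ r<8))

excess-step : ∀ ρ {r} → r < 8 →
  5 * ⟦ motif (next ρ) r ⟧ + excess ρ (child false r % 8) + excess ρ (child true r % 8) ≡ excess (next ρ) r + 4
excess-step ρ r<8 = ≡ᵇ⇒≡ _ _
  (all-∈ (step ρ) (upTo 8) (by-enumeration finite-Mod4 (λ ρ → all (step ρ) (upTo 8)) tt ρ) (∈-upTo⁺ r<8))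
  where
  step : Mod4 → ℕ → Bool
  step ρ r = 5 * ⟦ motif (next ρ) r ⟧ + excess ρ (child false r % 8) + excess ρ (child true r % 8)
               ≡ᵇ excess (next ρ) r + 4

chosen-below : ∀ {n h} v → 2 ≤ v → level v + h ≡ n → chosen n v ≡ motif (mod4 h) (v % 8)
chosen-below (suc zero) (s≤s ()) _
chosen-below {h = h} v@(suc (suc _)) _ refl
  rewrite ≤ᵇ-true (m≤m+n (level v) h) | m+n∸m≡n (level v) h = ∨-identityʳ _

combine-exact : ∀ X b c₁ c₂ d₁ d₂ d → 5 * c₁ + 4 ≡ 4 * X + d₁ → 5 * c₂ + 4 ≡ 4 * X + d₂ →
                5 * b + d₁ + d₂ ≡ d + 4 → 5 * (b + c₁ + c₂) + 4 ≡ 4 * (2 * X) + d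
combine-exact X b c₁ c₂ d₁ d₂ d e₁ e₂ step = +-cancelʳ-≡ 4 _ _ (begin
  5 * (b + c₁ + c₂) + 4 + 4             ≡⟨ spread b c₁ c₂ ⟩
  5 * b + (5 * c₁ + 4) + (5 * c₂ + 4)   ≡⟨ cong₂ (λ p q → 5 * b + p + q) e₁ e₂ ⟩
  5 * b + (4 * X + d₁) + (4 * X + d₂)   ≡⟨ regroup b X d₁ d₂ ⟩
  4 * (2 * X) + (5 * b + d₁ + d₂)       ≡⟨ cong (4 * (2 * X) +_) step ⟩
  4 * (2 * X) + (d + 4)                 ≡⟨ sym (+-assoc (4 * (2 * X)) d 4) ⟩
  4 * (2 * X) + d + 4                   ∎)
  where
  open ≡-Reasoning
  spread : ∀ b c₁ c₂ → 5 * (b + c₁ + c₂) + 4 + 4 ≡ 5 * b + (5 * c₁ + 4) + (5 * c₂ + 4)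
  spread = solve-∀
  regroup : ∀ b X d₁ d₂ → 5 * b + (4 * X + d₁) + (4 * X + d₂) ≡ 4 * (2 * X) + (5 * b + d₁ + d₂)
  regroup = solve-∀

count-exact : ∀ {n} h v → 2 ≤ v → level v + h ≡ n →
              5 * treeCount (chosen n) h v + 4 ≡ 4 * 2 ^ h + excess (mod4 h) (v % 8)
count-exact zero v v≥2 reaches rewrite chosen-below v v≥2 reaches = excess-leaf (m%n<n v 8)
count-exact {n} (suc h) v v≥2 reaches =
  combine-exact (2 ^ h) ⟦ chosen n v ⟧ _ _ _ _ _ (below false) (below true) (begin
    5 * ⟦ chosen n v ⟧ + excess ρ (child false v % 8) + excess ρ (child true v % 8)
      ≡⟨ cong₂ (λ b r → 5 * ⟦ b ⟧ + excess ρ r + excess ρ (child true v % 8)) (chosen-below v v≥2 reaches) (child-mod false v) ⟩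
    5 * ⟦ motif (next ρ) (v % 8) ⟧ + excess ρ (child false (v % 8) % 8) + excess ρ (child true v % 8)
      ≡⟨ cong (λ r → 5 * ⟦ motif (next ρ) (v % 8) ⟧ + excess ρ (child false (v % 8) % 8) + excess ρ r) (child-mod true v) ⟩
    5 * ⟦ motif (next ρ) (v % 8) ⟧ + excess ρ (child false (v % 8) % 8) + excess ρ (child true (v % 8) % 8)
      ≡⟨ excess-step ρ (m%n<n v 8) ⟩
    excess (next ρ) (v % 8) + 4 ∎)
  where
  open ≡-Reasoning
  ρ : Mod4
  ρ = mod4 h
  v≥1 : 1 ≤ v
  v≥1 = ≤-trans (s≤s z≤n) v≥2
  below : ∀ d → 5 * treeCount (chosen n) h (child d v) + 4 ≡ 4 * 2 ^ h + excess ρ (child d v % 8)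
  below d = count-exact h (child d v) (≤-trans v≥2 (<⇒≤ (child-> d v≥1)))
              (trans (cong (_+ h) (level-child d v≥1)) (trans (sym (+-suc (level v) h)) reaches))

-- The addresses of vertices that are anchored at G: grandchildren of G, and
-- also G and its children when G is the root.
centers : Bool → List Addr
centers false = (false ∷ false ∷ []) ∷ (false ∷ true ∷ []) ∷ (true ∷ false ∷ []) ∷ (true ∷ true ∷ []) ∷ []
centers true  = [] ∷ (false ∷ []) ∷ (true ∷ []) ∷ centers false

record Anchor (x : ℕ) : Set where
  field
    G      : ℕ
    a      : Addr
    G≥1    : 1 ≤ G
    x≡     : x ≡ pos G a
    center : a ∈ centers (G ≡ᵇ 1)

pair∈centers : ∀ root d₁ d₀ → (d₁ ∷ d₀ ∷ []) ∈ centers root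
pair∈centers root d₁ d₀ = grandchildren root (pair∈pairs d₁ d₀)
  where
  pair∈pairs : ∀ d₁ d₀ → (d₁ ∷ d₀ ∷ []) ∈ centers false
  pair∈pairs false false = here refl
  pair∈pairs false true  = there (here refl)
  pair∈pairs true  false = there (there (here refl))
  pair∈pairs true  true  = there (there (there (here refl)))
  grandchildren : ∀ root {a} → a ∈ centers false → a ∈ centers root
  grandchildren false a∈ = a∈
  grandchildren true  a∈ = there (there (there a∈))

-- Anchoring x at its grandparent (or at the root when x ≤ 3).
anchor : ∀ {x} → 1 ≤ x → Anchor x
anchor {x} x≥1 with split x
... | false , zero , refl = ⊥-elim (<-irrefl refl x≥1)
... | true  , zero , refl = record { G = 1 ; a = [] ; G≥1 = ≤-refl ; x≡ = refl ; center = here refl }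
... | d₁ , suc y , refl with split (suc y)
...   | false , zero , ()
...   | true , zero , e =
  record { G = 1 ; a = d₁ ∷ [] ; G≥1 = ≤-refl ; x≡ = cong (child d₁) e ; center = child-center d₁ }
  where
  child-center : ∀ d → (d ∷ []) ∈ centers true
  child-center false = there (here refl)
  child-center true  = there (there (here refl))
...   | d₀ , suc G , e = record { G = suc G ; a = d₁ ∷ d₀ ∷ [] ; G≥1 = s≤s z≤n ; x≡ = cong (child d₁) e
                                ; center = pair∈centers _ d₁ d₀ }

center-root : ∀ {G a} → a ∈ centers (G ≡ᵇ 1) → a ≡ [] → G ≡ 1
center-root {G} a∈ refl = ≡ᵇ⇒≡ G 1 (root-flag a∈)
  where
  root-flag : ∀ {root} → [] ∈ centers root → T root
  root-flag {true}  _ = tt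
  root-flag {false} (here ())
  root-flag {false} (there (here ()))
  root-flag {false} (there (there (here ())))
  root-flag {false} (there (there (there (here ()))))

center-length : ∀ {root a} → a ∈ centers root → length a ≤ 2
center-length {false} a∈ = ≤ᵇ⇒≤ _ _ (all-∈ (λ a → length a ≤ᵇ 2) (centers false) tt a∈)
center-length {true}  a∈ = ≤ᵇ⇒≤ _ _ (all-∈ (λ a → length a ≤ᵇ 2) (centers true) tt a∈)

neighbour-length : ∀ a {b} → b ∈ neighbours a → length b ≤ suc (length a)
neighbour-length []      (here refl)                         = ≤-refl
neighbour-length []      (there (here refl))                 = ≤-refl
neighbour-length (d ∷ a) (here refl)                         = ≤-refl
neighbour-length (d ∷ a) (there (here refl))                 = ≤-refl
neighbour-length (d ∷ a) (there (there (here refl)))         = ≤-trans (n≤1+n _) (n≤1+n _)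
neighbour-length (d ∷ a) (there (there (there (here refl)))) = n≤1+n _

_≟ᴬ_ : DecidableEquality Addr
_≟ᴬ_ = ≡-dec _≟𝔹_

_∈ᴬ?_ : ∀ a (as : List Addr) → Dec (a ∈ as)
_∈ᴬ?_ = DecMembership._∈?_ _≟ᴬ_

-- The construction as seen from an anchor G ≥ 1 with h = n − level G, g = G mod 8
-- and root = (G ≡ 1): the vertex at address a exists iff |a| ≤ h, and is chosen
-- as follows.
exists : ℕ → Addr → Bool
exists h a = length a ≤ᵇ h

model : ℕ → ℕ → Bool → Addr → Bool
model h g root a = exists h a ∧ (motif (mod4 (h ∸ length a)) (pos g a % 8) ∨ (root ∧ null a ∧ rootChosen (mod4 h)))

dominatingᵇ : ℕ → ℕ → Bool → Bool
dominatingᵇ h g root = all (λ a → not (exists h a) ∨ model h g root a ∨ any (model h g root) (neighbours a)) (centers root)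

separatedᵇ : ℕ → ℕ → Bool → Addr → Addr → Bool
separatedᵇ h g root u w =
  not (exists h u ∧ exists h w ∧ not (model h g root u) ∧ not (model h g root w) ∧ not (isYes (u ≟ᴬ w))) ∨
  any (λ z → model h g root z ∧ not (isYes (z ∈ᴬ? neighbours w))) (neighbours u) ∨
  any (λ z → model h g root z ∧ not (isYes (z ∈ᴬ? neighbours u))) (neighbours w)

locatingᵇ : ℕ → ℕ → Bool → Bool
locatingᵇ h g root = all (λ t → not (model h g root t) ∨
  all (λ u → all (separatedᵇ h g root u) (neighbours t)) (neighbours t)) (centers root)

checksᵇ : ℕ → ℕ → Bool → Bool
checksᵇ h g root = dominatingᵇ h g root ∧ locatingᵇ h g root

checks-row : ℕ → Bool
checks-row h = all (λ g → checksᵇ h g false) (upTo 8) ∧ checksᵇ h 1 true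

all-checks : T (all checks-row (upTo 8))
all-checks = tt

local-checks : ∀ {h g} root → h < 8 → g < 8 → (root ≡ true → g ≡ 1) → T (checksᵇ h g root)
local-checks {h} {g} root h<8 g<8 g≡1
  with ∧-split {all (λ g → checksᵇ h g false) (upTo 8)} (all-∈ checks-row (upTo 8) all-checks (∈-upTo⁺ h<8))
local-checks {h} {g} false h<8 g<8 _   | every-g , _ = all-∈ (λ g → checksᵇ h g false) (upTo 8) every-g (∈-upTo⁺ g<8)
local-checks {h} {g} true  h<8 g<8 g≡1 | _ , at-root = subst (λ g → T (checksᵇ h g true)) (sym (g≡1 refl)) at-root

pos-mod : ∀ G a → pos G a % 8 ≡ pos (G % 8) a % 8
pos-mod G []      = sym (m%n%n≡m%n G 8)
pos-mod G (d ∷ a) = begin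
  child d (pos G a) % 8              ≡⟨ child-mod d (pos G a) ⟩
  child d (pos G a % 8) % 8          ≡⟨ cong (λ r → child d r % 8) (pos-mod G a) ⟩
  child d (pos (G % 8) a % 8) % 8    ≡⟨ sym (child-mod d (pos (G % 8) a)) ⟩
  child d (pos (G % 8) a) % 8        ∎
  where open ≡-Reasoning

pos-is-root : ∀ {G} a → 1 ≤ G → (pos G a ≡ᵇ 1) ≡ (G ≡ᵇ 1) ∧ null a
pos-is-root []      G≥1 = sym (∧-identityʳ _)
pos-is-root {G} (d ∷ a) G≥1 = trans (above-root (≤-<-trans G≥1 (pos-> d a G≥1))) (sym (∧-zeroʳ (G ≡ᵇ 1)))
  where
  above-root : ∀ {x} → 1 < x → (x ≡ᵇ 1) ≡ false
  above-root {suc zero}    (s≤s ())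
  above-root {suc (suc _)} _ = refl

≤ᵇ-shift : ∀ k l n → l ≤ n → (l + k ≤ᵇ n) ≡ (k ≤ᵇ n ∸ l)
≤ᵇ-shift k l n l≤n = does-⇔ (mk⇔ to from) (l + k ≤? n) (k ≤? n ∸ l)
  where
  to : l + k ≤ n → k ≤ n ∸ l
  to le = ≤-trans (≤-reflexive (sym (m+n∸m≡n l k))) (∸-monoˡ-≤ l le)
  from : k ≤ n ∸ l → l + k ≤ n
  from le = ≤-trans (+-monoʳ-≤ l le) (≤-reflexive (m+[n∸m]≡n l≤n))

-- The root summand only matters at the root, whose level is 0.
root-summand : ∀ G n X → (G ≡ᵇ 1) ∧ X ∧ rootChosen (mod4 n) ≡ (G ≡ᵇ 1) ∧ X ∧ rootChosen (mod4 (n ∸ level G))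
root-summand zero          n X = refl
root-summand (suc zero)    n X = refl
root-summand (suc (suc G)) n X = refl

chosen-model : ∀ {n G} a → 1 ≤ G → level G ≤ n →
               chosen n (pos G a) ≡ model (n ∸ level G) (G % 8) (G ≡ᵇ 1) a
chosen-model {n} {G} a G≥1 level≤n
  rewrite ≤ᵇ-true (≤-trans G≥1 (pos-≥ G a))
        | level-pos a G≥1
        | ≤ᵇ-shift (length a) (level G) n level≤n
        | sym (∸-+-assoc n (level G) (length a))
        | pos-mod G a
        | pos-is-root a G≥1
        | ∧-assoc (G ≡ᵇ 1) (null a) (rootChosen (mod4 n))
        | root-summand G n (null a) = refl

-- clip h < 8 has the residue of h mod 4 and agrees with h up to 4: this is all
-- the model can see of h on addresses of length ≤ 4.
clip : ℕ → ℕ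
clip (suc (suc (suc (suc (suc (suc (suc (suc h)))))))) = clip (suc (suc (suc (suc h))))
clip h = h

clip<8 : ∀ h → clip h < 8
clip<8 (suc (suc (suc (suc (suc (suc (suc (suc h)))))))) = clip<8 (suc (suc (suc (suc h))))
clip<8 0 = ≤ᵇ⇒≤ _ _ tt
clip<8 1 = ≤ᵇ⇒≤ _ _ tt
clip<8 2 = ≤ᵇ⇒≤ _ _ tt
clip<8 3 = ≤ᵇ⇒≤ _ _ tt
clip<8 4 = ≤ᵇ⇒≤ _ _ tt
clip<8 5 = ≤ᵇ⇒≤ _ _ tt
clip<8 6 = ≤ᵇ⇒≤ _ _ tt
clip<8 7 = ≤ᵇ⇒≤ _ _ tt

mod4-4+ : ∀ h → mod4 (4 + h) ≡ mod4 h
mod4-4+ h with mod4 h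
... | r0 = refl
... | r1 = refl
... | r2 = refl
... | r3 = refl

exists-shift : ∀ h a → length a ≤ 4 → 4 ≤ h → exists (4 + h) a ≡ exists h a
exists-shift h a |a|≤4 4≤h = trans (≤ᵇ-true (≤-trans |a|≤4 (m≤m+n 4 h))) (sym (≤ᵇ-true (≤-trans |a|≤4 4≤h)))

model-shift : ∀ h g root a → length a ≤ 4 → 4 ≤ h → model (4 + h) g root a ≡ model h g root a
model-shift h g root a |a|≤4 4≤h
  rewrite exists-shift h a |a|≤4 4≤h
        | +-∸-assoc 4 (≤-trans |a|≤4 4≤h)
        | mod4-4+ (h ∸ length a)
        | mod4-4+ h = refl

clip-exists : ∀ h a → length a ≤ 4 → exists h a ≡ exists (clip h) a
clip-exists (suc (suc (suc (suc (suc (suc (suc (suc h)))))))) a |a|≤4 =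
  trans (exists-shift (suc (suc (suc (suc h)))) a |a|≤4 (s≤s (s≤s (s≤s (s≤s z≤n)))))
        (clip-exists (suc (suc (suc (suc h)))) a |a|≤4)
clip-exists 0 a _ = refl
clip-exists 1 a _ = refl
clip-exists 2 a _ = refl
clip-exists 3 a _ = refl
clip-exists 4 a _ = refl
clip-exists 5 a _ = refl
clip-exists 6 a _ = refl
clip-exists 7 a _ = refl

clip-model : ∀ h g root a → length a ≤ 4 → model h g root a ≡ model (clip h) g root a
clip-model (suc (suc (suc (suc (suc (suc (suc (suc h)))))))) g root a |a|≤4 =
  trans (model-shift (suc (suc (suc (suc h)))) g root a |a|≤4 (s≤s (s≤s (s≤s (s≤s z≤n)))))
        (clip-model (suc (suc (suc (suc h)))) g root a |a|≤4)
clip-model 0 g root a _ = refl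
clip-model 1 g root a _ = refl
clip-model 2 g root a _ = refl
clip-model 3 g root a _ = refl
clip-model 4 g root a _ = refl
clip-model 5 g root a _ = refl
clip-model 6 g root a _ = refl
clip-model 7 g root a _ = refl

module UpperBound (n : ℕ) where

  construction : List ℕ
  construction = filterᵇ (chosen n) (subtree n 1)

  chosen⇒vertex : ∀ {x} → T (chosen n x) → Vertex n x
  chosen⇒vertex {x} t =
    let (x≥1 , t₁) = ∧-split {1 ≤ᵇ x} t ; (lvl≤n , _) = ∧-split {level x ≤ᵇ n} t₁
    in level⇒vertex (≤ᵇ⇒≤ 1 x x≥1) (≤ᵇ⇒≤ (level x) n lvl≤n)

  chosen⇒∈ : ∀ {x} → T (chosen n x) → x ∈ construction
  chosen⇒∈ t = ∈-filter⁺ (T? ∘ chosen n) (vertex⇒∈-subtree {n} (chosen⇒vertex t)) t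

  ∈⇒chosen : ∀ {x} → x ∈ construction → T (chosen n x)
  ∈⇒chosen x∈ = proj₂ (∈-filter⁻ (T? ∘ chosen n) {xs = subtree n 1} x∈)

  Indistinguishable : ℕ → ℕ → Set
  Indistinguishable u w = ∀ s → s ∈ construction → (Adj u s → Adj w s) × (Adj w s → Adj u s)

  anchor-level : ∀ {G} a → 1 ≤ G → Vertex n (pos G a) → level G ≤ n
  anchor-level a G≥1 v = ≤-trans (m≤m+n _ (length a)) (≤-trans (≤-reflexive (sym (level-pos a G≥1))) (vertex⇒level v))

  module Window {G} (G≥1 : 1 ≤ G) (level≤n : level G ≤ n) where
    h g : ℕ
    h = clip (n ∸ level G)
    g = G % 8
    root : Bool
    root = G ≡ᵇ 1

    checks : T (checksᵇ h g root)
    checks = local-checks root (clip<8 (n ∸ level G)) (m%n<n G 8) root⇒g≡1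
      where
      root⇒g≡1 : root ≡ true → g ≡ 1
      root⇒g≡1 e = cong (_% 8) (≡ᵇ⇒≡ G 1 (subst T (sym e) tt))

    chosen-window : ∀ a → length a ≤ 4 → chosen n (pos G a) ≡ model h g root a
    chosen-window a |a|≤4 = trans (chosen-model a G≥1 level≤n) (clip-model (n ∸ level G) g root a |a|≤4)

    model⇒∈ : ∀ a → length a ≤ 4 → T (model h g root a) → pos G a ∈ construction
    model⇒∈ a |a|≤4 t = chosen⇒∈ (subst T (sym (chosen-window a |a|≤4)) t)

    ∉⇒¬model : ∀ a → length a ≤ 4 → pos G a ∉ construction → T (not (model h g root a))
    ∉⇒¬model a |a|≤4 ∉ = refute (∉ ∘ model⇒∈ a |a|≤4)

    ∈⇒model : ∀ a → length a ≤ 4 → pos G a ∈ construction → T (model h g root a)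
    ∈⇒model a |a|≤4 ∈ = subst T (chosen-window a |a|≤4) (∈⇒chosen ∈)

    vertex⇒exists : ∀ a → length a ≤ 4 → Vertex n (pos G a) → T (exists h a)
    vertex⇒exists a |a|≤4 v = subst T (clip-exists (n ∸ level G) a |a|≤4) (≤⇒≤ᵇ (begin
      length a                              ≡⟨ sym (m+n∸m≡n (level G) (length a)) ⟩
      level G + length a ∸ level G          ≡⟨ cong (_∸ level G) (sym (level-pos a G≥1)) ⟩
      level (pos G a) ∸ level G             ≤⟨ ∸-monoˡ-≤ (level G) (vertex⇒level v) ⟩
      n ∸ level G                           ∎))
      where open ≤-Reasoning

    short : ∀ {t a} → t ∈ centers root → a ∈ neighbours t → length a ≤ 4
    short {t} t∈ a∈ = ≤-trans (neighbour-length t a∈) (s≤s (≤-trans (center-length t∈) (s≤s (s≤s z≤n))))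

    dominated-at : ∀ {a} → a ∈ centers root → Vertex n (pos G a) → pos G a ∉ construction →
                   ∃ λ s → s ∈ construction × Adj (pos G a) s
    dominated-at {a} a∈ v ∉ =
      let |a|≤4 = ≤-trans (center-length a∈) (s≤s (s≤s z≤n))
          check = all-∈ (λ a → not (exists h a) ∨ model h g root a ∨ any (model h g root) (neighbours a))
                        (centers root) (proj₁ (∧-split {dominatingᵇ h g root} checks)) a∈
          found = resolve {model h g root a} (implication {exists h a} check (vertex⇒exists a |a|≤4 v))
                          (∉⇒¬model a |a|≤4 ∉)
          (z , z∈ , tz) = find (any⁻ (model h g root) (neighbours a) found)
      in pos G z , model⇒∈ z (short a∈ z∈) tz , neighbours-adjacent G≥1 a z∈

    separating : ∀ {t u w z} → t ∈ centers root → u ∈ neighbours t → z ∈ neighbours u →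
                 T (model h g root z ∧ not (isYes (z ∈ᴬ? neighbours w))) →
                 ¬ (∀ {s} → s ∈ construction → Adj (pos G u) s → Adj (pos G w) s)
    separating {t} {u} {w} {z} t∈ u∈ z∈ tz follows =
      let (chosen-z , z∉w) = ∧-split {model h g root z} tz
          z|≤4 = ≤-trans (neighbour-length u z∈) (s≤s (≤-trans (neighbour-length t u∈) (s≤s (center-length t∈))))
      in toWitnessFalse z∉w
           (adjacent-neighbours G≥1 w z (follows (model⇒∈ z z|≤4 chosen-z) (neighbours-adjacent G≥1 u z∈)))

    located-at : ∀ {t u w} → t ∈ centers root → pos G t ∈ construction → u ∈ neighbours t → w ∈ neighbours t →
                 Vertex n (pos G u) → Vertex n (pos G w) → pos G u ∉ construction → pos G w ∉ construction →
                 u ≢ w → ¬ Indistinguishable (pos G u) (pos G w)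
    located-at {t} {u} {w} t∈ t-in u∈ w∈ vu vw u∉ w∉ u≢w same = by-witness (Equivalence.to T-∨ distinguished)
      where
      near-t : Addr → Bool
      near-t u = all (separatedᵇ h g root u) (neighbours t)
      around-t : T (all near-t (neighbours t))
      around-t = implication (all-∈ (λ t → not (model h g root t) ∨ all (λ u → all (separatedᵇ h g root u) (neighbours t))
                                                                          (neighbours t))
                                    (centers root) (proj₂ (∧-split {dominatingᵇ h g root} checks)) t∈)
                             (∈⇒model t (≤-trans (center-length t∈) (s≤s (s≤s z≤n))) t-in)
      separated : T (separatedᵇ h g root u w)
      separated = all-∈ (separatedᵇ h g root u) (neighbours t) (all-∈ near-t (neighbours t) around-t u∈) w∈
      apart : T (exists h u ∧ exists h w ∧ not (model h g root u) ∧ not (model h g root w) ∧ not (isYes (u ≟ᴬ w)))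
      apart = ∧-intro (vertex⇒exists u (short t∈ u∈) vu) (∧-intro (vertex⇒exists w (short t∈ w∈) vw)
                (∧-intro (∉⇒¬model u (short t∈ u∈) u∉) (∧-intro (∉⇒¬model w (short t∈ w∈) w∉)
                  (fromWitnessFalse u≢w))))
      tells : Addr → Addr → Bool
      tells other z = model h g root z ∧ not (isYes (z ∈ᴬ? neighbours other))
      distinguished : T (any (tells w) (neighbours u) ∨ any (tells u) (neighbours w))
      distinguished = implication separated apart
      by-witness : T (any (tells w) (neighbours u)) ⊎ T (any (tells u) (neighbours w)) → ⊥
      by-witness (inj₁ found) = let (z , z∈ , tz) = find (any⁻ (tells w) (neighbours u) found)
                                in separating t∈ u∈ z∈ tz (λ s∈ → proj₁ (same _ s∈))
      by-witness (inj₂ found) = let (z , z∈ , tz) = find (any⁻ (tells u) (neighbours w) found)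
                                in separating t∈ w∈ z∈ tz (λ s∈ → proj₂ (same _ s∈))

  dominating : ∀ v → Vertex n v → v ∉ construction → ∃ λ s → s ∈ construction × Adj v s
  dominating v vert v∉ with anchor {v} (proj₁ vert)
  ... | record { G = G ; a = a ; G≥1 = G≥1 ; x≡ = refl ; center = a∈ } =
    Window.dominated-at G≥1 (anchor-level a G≥1 vert) a∈ vert v∉

  -- ... and locating: a chosen neighbour t of u is also one of w, so u and w
  -- are neighbours of the anchored vertex t and are told apart near it.
  locating : ∀ u w → Vertex n u → Vertex n w → u ∉ construction → w ∉ construction → u ≢ w →
             ¬ Indistinguishable u w
  locating u w vu vw u∉ w∉ u≢w same with dominating u vu u∉
  ... | t , t-in , ut with chosen⇒vertex (∈⇒chosen t-in)
  ... | vt with anchor {t} (proj₁ vt)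
  ... | record { G = G ; a = at ; G≥1 = G≥1 ; x≡ = refl ; center = at∈ }
    with neighbour-address at G≥1 (center-root at∈) (proj₁ vu) (Adj-sym ut)
       | neighbour-address at G≥1 (center-root at∈) (proj₁ vw) (Adj-sym (proj₁ (same _ t-in) ut))
  ... | au , au∈ , refl | aw , aw∈ , refl =
    Window.located-at G≥1 (anchor-level at G≥1 vt) at∈ t-in au∈ aw∈ vu vw u∉ w∉ (u≢w ∘ cong (pos G)) same

  construction-locDom : IsLocDom n construction
  construction-locDom = record
    { unique    = Unique.filter⁺ (T? ∘ chosen n) (subtree-unique n 1 ≤-refl)
    ; vertices  = chosen⇒vertex ∘ ∈⇒chosen
    ; dominates = dominating
    ; locates   = locating
    }

numerator : Mod4 → ℕ → ℕ
numerator r0 N = N + 1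
numerator r1 N = N + 2
numerator r2 N = N ∸ 1
numerator r3 N = N ∸ 2

residue : Mod4 → ℕ
residue r0 = 0
residue r1 = 1
residue r2 = 2
residue r3 = 3

mod4-% : ∀ n → n % 4 ≡ residue (mod4 n)
mod4-% zero    = refl
mod4-% (suc n) = trans (%-distribˡ-+ 1 n 4) (trans (cong (λ r → (1 + r) % 4) (mod4-% n)) (step (mod4 n)))
  where
  step : ∀ ρ → (1 + residue ρ) % 4 ≡ residue (next ρ)
  step r0 = refl
  step r1 = refl
  step r2 = refl
  step r3 = refl

formula-numerator : ∀ n → formula n ≡ numerator (mod4 n) (4 * 2 ^ n) / 5
formula-numerator n = begin
  formula n                                  ≡⟨ by-residue n ⟩
  at (n % 4) (2 ^ (n + 2)) / 5               ≡⟨ cong₂ (λ r N → at r N / 5) (mod4-% n) (four-times n) ⟩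
  at (residue (mod4 n)) (4 * 2 ^ n) / 5      ≡⟨ cong (_/ 5) (at-residue (mod4 n) (4 * 2 ^ n)) ⟩
  numerator (mod4 n) (4 * 2 ^ n) / 5         ∎
  where
  at : ℕ → ℕ → ℕ
  at 0 N = N + 1
  at 1 N = N + 2
  at 2 N = N ∸ 1
  at _ N = N ∸ 2
  open ≡-Reasoning
  at-residue : ∀ ρ N → at (residue ρ) N ≡ numerator ρ N
  at-residue r0 N = refl
  at-residue r1 N = refl
  at-residue r2 N = refl
  at-residue r3 N = refl
  by-residue : ∀ n → formula n ≡ at (n % 4) (2 ^ (n + 2)) / 5
  by-residue n with n % 4
  ... | 0 = refl
  ... | 1 = refl
  ... | 2 = refl
  ... | suc (suc (suc _)) = refl
  four-times : ∀ n → 2 ^ (n + 2) ≡ 4 * 2 ^ n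
  four-times n = trans (cong (2 ^_) (+-comm n 2)) (quadruple (2 ^ n))
    where quadruple : ∀ p → 2 * (2 * p) ≡ 4 * p
          quadruple = solve-∀

/5-≤ : ∀ {a} L → a ≤ 5 * L → a / 5 ≤ L
/5-≤ L a≤ = ≤-trans (/-monoˡ-≤ 5 (≤-trans a≤ (≤-reflexive (*-comm 5 L)))) (≤-reflexive (m*n/n≡m L 5))

/5-≡ : ∀ {a} L → a ≡ 5 * L → a / 5 ≡ L
/5-≡ L refl = trans (cong (_/ 5) (*-comm 5 L)) (m*n/n≡m L 5)

-- The least surplus of the whole tree, whose root has no outside neighbour.
least-surplus : Mod4 → ℕ
least-surplus r0 = 5
least-surplus r1 = 6
least-surplus r2 = 3
least-surplus r3 = 2

least-surplus-≤ : ∀ ρ bv k → least-surplus ρ ≤ surplus ρ false bv k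
least-surplus-≤ ρ bv k = ≤ᵇ⇒≤ _ _ (by-enumeration (finite-× finite-Mod4 (finite-× finite-Bool finite-Bool))
  (λ (ρ , bv , k) → least-surplus ρ ≤ᵇ surplus ρ false bv k) tt (ρ , bv , k))

numerator-≤ : ∀ ρ N L → N + least-surplus ρ ≤ 5 * L + 4 → numerator ρ N ≤ 5 * L
numerator-≤ r0 N L le = +-cancelʳ-≤ 4 _ _ (≤-trans (≤-reflexive (+-assoc N 1 4)) le)
numerator-≤ r1 N L le = +-cancelʳ-≤ 4 _ _ (≤-trans (≤-reflexive (+-assoc N 2 4)) le)
numerator-≤ r2 N L le = ≤-trans (∸-monoˡ-≤ 1 (+-cancelʳ-≤ 3 _ _ (≤-trans le (≤-reflexive (sym (+-assoc (5 * L) 1 3))))))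
                                (≤-reflexive (m+n∸n≡m (5 * L) 1))
numerator-≤ r3 N L le = ≤-trans (∸-monoˡ-≤ 2 (+-cancelʳ-≤ 2 _ _ (≤-trans le (≤-reflexive (sym (+-assoc (5 * L) 2 2))))))
                                (≤-reflexive (m+n∸n≡m (5 * L) 2))

lower-bound : ∀ n S → IsLocDom n S → formula n ≤ length S
lower-bound n S L = begin
  formula n                                ≡⟨ formula-numerator n ⟩
  numerator (mod4 n) (4 * 2 ^ n) / 5       ≤⟨ /5-≤ (length S) (numerator-≤ (mod4 n) (4 * 2 ^ n) (length S) (≤-trans
                                                 (+-monoʳ-≤ (4 * 2 ^ n) (least-surplus-≤ (mod4 n) _ _)) root-bound)) ⟩
  length S                                 ∎
  where
  open ≤-Reasoning
  open LowerBound L using (root-bound)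

-- The construction is counted from the exact counts below the two children of
-- the root (the value of ⟦ rootChosen ⟧ and of excess at 2 and 3 enter here).
numerator-≡ : ∀ ρ X c₂ c₃ → 5 * c₂ + 4 ≡ 4 * X + excess ρ 2 → 5 * c₃ + 4 ≡ 4 * X + excess ρ 3 →
              numerator (next ρ) (4 * (2 * X)) ≡ 5 * (⟦ rootChosen (next ρ) ⟧ + c₂ + c₃)
numerator-≡ r0 X c₂ c₃ e₂ e₃ =
  +-cancelʳ-≡ 4 _ _ (trans (+-assoc (4 * (2 * X)) 2 4) (sym (combine-exact X 1 c₂ c₃ 5 0 6 e₂ e₃ refl)))
numerator-≡ r1 X c₂ c₃ e₂ e₃ =
  trans (cong (_∸ 1) (+-cancelʳ-≡ 3 _ _
          (sym (trans (+-assoc (5 * (0 + c₂ + c₃)) 1 3) (combine-exact X 0 c₂ c₃ 6 1 3 e₂ e₃ refl)))))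
        (m+n∸n≡m _ 1)
numerator-≡ r2 X c₂ c₃ e₂ e₃ =
  trans (cong (_∸ 2) (+-cancelʳ-≡ 2 _ _
          (sym (trans (+-assoc (5 * (0 + c₂ + c₃)) 2 2) (combine-exact X 0 c₂ c₃ 3 3 2 e₂ e₃ refl)))))
        (m+n∸n≡m _ 2)
numerator-≡ r3 X c₂ c₃ e₂ e₃ =
  +-cancelʳ-≡ 4 _ _ (trans (+-assoc (4 * (2 * X)) 1 4) (sym (combine-exact X 1 c₂ c₃ 2 2 5 e₂ e₃ refl)))

-- The motif never chooses residue 1, so the root is chosen only as the root.
motif-one : ∀ ρ → motif ρ 1 ≡ false
motif-one r0 = refl
motif-one r1 = refl
motif-one r2 = refl
motif-one r3 = refl

chosen-root : ∀ n → chosen n 1 ≡ rootChosen (mod4 n)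
chosen-root n rewrite motif-one (mod4 n) = refl

construction-size : ∀ m → length (UpperBound.construction (suc m)) ≡ formula (suc m)
construction-size m = sym (begin
  formula n                                 ≡⟨ formula-numerator n ⟩
  numerator (mod4 n) (4 * 2 ^ n) / 5        ≡⟨ /5-≡ _ (numerator-≡ (mod4 m) (2 ^ m) c₂ c₃ below-2 below-3) ⟩
  ⟦ rootChosen (mod4 n) ⟧ + c₂ + c₃         ≡⟨ cong (λ b → ⟦ b ⟧ + c₂ + c₃) (sym (chosen-root n)) ⟩
  treeCount (chosen n) n 1                  ≡⟨ sym (treeCount-filter (chosen n) n 1) ⟩
  length (UpperBound.construction n)        ∎)
  where
  open ≡-Reasoning
  n c₂ c₃ : ℕ
  n  = suc m
  c₂ = treeCount (chosen n) m 2
  c₃ = treeCount (chosen n) m 3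
  below-2 : 5 * c₂ + 4 ≡ 4 * 2 ^ m + excess (mod4 m) 2
  below-2 = count-exact m 2 ≤-refl refl
  below-3 : 5 * c₃ + 4 ≡ 4 * 2 ^ m + excess (mod4 m) 3
  below-3 = count-exact m 3 (s≤s (s≤s z≤n)) refl

theorem7 : (n : ℕ) → 1 ≤ n → IsLocDomNumber n (formula n)
theorem7 (suc m) _ =
  (UpperBound.construction (suc m) , UpperBound.construction-locDom (suc m) , construction-size m) ,
  lower-bound (suc m)
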